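{- Let $k \geq 10^8$. Start with the empty graph on $k$ vertices and add the edges of $K_k$ one at a time in some order until the graph is complete. Then there exists a vertex $v$ such that at least $\frac{k^2}{3}-\frac{k^2}{(\log k)^2}$ edges $w_iw_j$ (with $w_i,w_j\neq v$) have the property that, at the moment the edge $w_iw_j$ was added, both $w_i$ and $w_j$ were already in the connected component of $v$ in the graph built so far. -}

module Defs where

open import Data.Nat using (ℕ; zero; suc; _+_; _*_; _^_; _≤_; _<_)
open import Data.Fin using (Fin; toℕ)
open import Data.Product using (_×_; _,_)
open import Data.Sum using (_⊎_)
open import Data.List using (List; length; lookup; take)
open import Data.List.Membership.Propositional using (_∈_)
open import Data.List.Relation.Unary.All using (All)
open import Data.List.Relation.Unary.Unique.Propositional using (Unique)
open import Relation.Binary.PropositionalEquality using (_≢_)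

-- An edge of K_k is represented as an ordered pair (i , j) with toℕ i < toℕ j.
Edge : ℕ → Set
Edge k = Fin k × Fin k

IsEdgeOrdering : (k : ℕ) → List (Edge k) → Set
IsEdgeOrdering k es =
  All (λ { (i , j) → toℕ i < toℕ j }) es
  × Unique es
  × (∀ (i j : Fin k) → toℕ i < toℕ j → (i , j) ∈ es)

data Conn {k : ℕ} (E : List (Edge k)) (u : Fin k) : Fin k → Set where
  here : Conn E u u
  step : ∀ {w x} → Conn E u w → ((w , x) ∈ E ⊎ (x , w) ∈ E) → Conn E u x

Good : {k : ℕ} → (es : List (Edge k)) → Fin k → Fin (length es) → Set
Good es v t with lookup es t
... | (a , b) = (a ≢ v) × (b ≢ v)
              × Conn (take (toℕ t) es) v a × Conn (take (toℕ t) es) v b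

-- expSum a n = n! * Σ_{i=0}^{n} a^i / i!   (a natural number), defined by
-- expSum a 0 = 1,  expSum a (n+1) = (n+1) * expSum a n + a^(n+1).
expSum : ℕ → ℕ → ℕ
expSum a zero = 1
expSum a (suc n) = suc n * expSum a n + a ^ suc n

factorial : ℕ → ℕ
factorial zero = 1
factorial (suc n) = suc n * factorial n

-- e^a ≤ k^b  (i.e. a/b ≤ ln k when b > 0): every partial sum of the
-- exponential series is ≤ k^b.
ExpLe : ℕ → ℕ → ℕ → Set
ExpLe a b k = ∀ (n : ℕ) → expSum a n ≤ k ^ b * factorial n

module Submission where

-- Components of the growing graph are tracked by union–find labels, which makes "both
-- endpoints lie in the component of v" decidable.  For distinct vertices x, y, z consider the
-- three edges of the triangle xyz: every one of them except the earliest either merges two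
-- components when it is added, or at that moment its endpoints are already connected to each
-- other and to the opposite vertex, i.e. it is good for that vertex.  At most k edges merge,
-- so summing over the at least k³ − 3k² ordered triples of distinct vertices gives at least
-- k³/3 − 2k² pairs (v, edge good for v), and some vertex has at least k²/3 − 2k good edges.
-- Finally a/b ≤ ln k and k ≥ 1024 give 2a² ≤ kb², so the error term 2k is at most k²b²/a².

open import Defs
open import Data.Bool using (true; false)
open import Data.Empty using (⊥-elim)
open import Data.Fin using (Fin; zero; suc; toℕ) renaming (_<_ to _<ᶠ_)
open import Data.Fin.Properties using (_≟_; suc-injective; <-cmp)
open import Data.List
  using (List; []; _∷_; [_]; _++_; _∷ʳ_; length; lookup; take; filter; tabulate; allFin; foldl)
open import Data.List.Membership.Propositional using (_∈_)
open import Data.List.Membership.Propositional.Properties using (∈-++⁺ˡ; ∈-++⁺ʳ; ∈-++⁻; ∈-lookup)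
open import Data.List.Properties using (++-identityʳ; ++-assoc; take-suc; foldl-∷ʳ)
open import Data.List.Relation.Binary.Subset.Propositional using (_⊆_)
open import Data.List.Relation.Unary.All using (All)
import Data.List.Relation.Unary.All as All
open import Data.List.Relation.Unary.All.Properties using (all-filter)
open import Data.List.Relation.Unary.AllPairs using (_∷_)
open import Data.List.Relation.Unary.Any using (here; there; index)
open import Data.List.Relation.Unary.Any.Properties using (lookup-index)
open import Data.List.Relation.Unary.Unique.Propositional using (Unique)
import Data.List.Relation.Unary.Unique.Propositional.Properties as Unique
open import Data.Nat using (ℕ; zero; suc; _+_; _*_; _^_; _≤_; _<_; z≤n; s≤s)
open import Data.Nat.Properties hiding (_≟_; <-cmp; suc-injective)
open import Algebra.Properties.Semiring.Sum +-*-semiring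
  using (sum; sum-syntax; ∑-distrib-+; ∑-comm; sum-cong-≗; *-distribˡ-sum)
open import Data.Nat.Tactic.RingSolver using (solve-∀)
open import Data.Product using (Σ; _×_; _,_; proj₁; proj₂; swap)
open import Data.Product.Properties using (,-injective) renaming (≡-dec to ×-≡-dec)
open import Data.Sum using (_⊎_; inj₁; inj₂; [_,_]′)
open import Function using (id; _∘_; _⇔_; mk⇔; Equivalence)
open import Relation.Binary.Definitions using (tri<; tri≈; tri>)
open import Relation.Binary.PropositionalEquality
  using (_≡_; _≢_; ≢-sym; refl; sym; trans; cong; cong₂; subst; subst₂; module ≡-Reasoning)
open import Relation.Nullary using (Dec; _because_; yes; no; ¬_; ¬?; _×-dec_; _⊎-dec_)
open import Relation.Nullary.Decidable using (decidable-stable)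
open import Relation.Unary using (Pred; Decidable)

𝟙 : ∀ {p} {P : Set p} → Dec P → ℕ
𝟙 (true  because _) = 1
𝟙 (false because _) = 0

𝟙≤1 : ∀ {p} {P : Set p} (P? : Dec P) → 𝟙 P? ≤ 1
𝟙≤1 (yes _) = ≤-refl
𝟙≤1 (no _)  = z≤n

𝟙-yes : ∀ {p} {P : Set p} (P? : Dec P) → P → 𝟙 P? ≡ 1
𝟙-yes (yes _) _ = refl
𝟙-yes (no ¬p) p = ⊥-elim (¬p p)

𝟙-no : ∀ {p} {P : Set p} (P? : Dec P) → ¬ P → 𝟙 P? ≡ 0
𝟙-no (yes p) ¬p = ⊥-elim (¬p p)
𝟙-no (no _)  _  = refl

𝟙-mono : ∀ {p q} {P : Set p} {Q : Set q} (P? : Dec P) (Q? : Dec Q) → (P → Q) → 𝟙 P? ≤ 𝟙 Q?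
𝟙-mono (yes p) (no ¬q) P⇒Q = ⊥-elim (¬q (P⇒Q p))
𝟙-mono (yes _) (yes _) _   = ≤-refl
𝟙-mono (no _)  _       _   = z≤n

𝟙-cong : ∀ {p q} {P : Set p} {Q : Set q} (P? : Dec P) (Q? : Dec Q) → P ⇔ Q → 𝟙 P? ≡ 𝟙 Q?
𝟙-cong P? Q? P⇔Q =
  ≤-antisym (𝟙-mono P? Q? (Equivalence.to P⇔Q)) (𝟙-mono Q? P? (Equivalence.from P⇔Q))

𝟙-⊎ : ∀ {p q} {P : Set p} {Q : Set q} (P? : Dec P) (Q? : Dec Q) → (P → ¬ Q) →
  𝟙 (P? ⊎-dec Q?) ≡ 𝟙 P? + 𝟙 Q?
𝟙-⊎ (yes p) (yes q) disjoint = ⊥-elim (disjoint p q)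
𝟙-⊎ (yes _) (no _)  _        = refl
𝟙-⊎ (no _)  (yes _) _        = refl
𝟙-⊎ (no _)  (no _)  _        = refl

𝟙-× : ∀ {p q} {P : Set p} {Q : Set q} (P? : Dec P) (Q? : Dec Q) → 𝟙 (P? ×-dec Q?) ≡ 𝟙 P? * 𝟙 Q?
𝟙-× (yes _) (yes _) = refl
𝟙-× (yes _) (no _)  = refl
𝟙-× (no _)  _       = refl

∑-mono-≤ : ∀ {n} {f g : Fin n → ℕ} → (∀ i → f i ≤ g i) → ∑[ i < n ] f i ≤ ∑[ i < n ] g i
∑-mono-≤ {zero}  f≤g = z≤n
∑-mono-≤ {suc n} f≤g = +-mono-≤ (f≤g zero) (∑-mono-≤ (f≤g ∘ suc))

∑-mono-< : ∀ {n} {f g : Fin n → ℕ} → (∀ i → f i ≤ g i) → ∀ i₀ → f i₀ < g i₀ →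
  ∑[ i < n ] f i < ∑[ i < n ] g i
∑-mono-< f≤g zero    fi<gi = +-mono-<-≤ fi<gi (∑-mono-≤ (f≤g ∘ suc))
∑-mono-< f≤g (suc i) fi<gi = +-mono-≤-< (f≤g zero) (∑-mono-< (f≤g ∘ suc) i fi<gi)

∑-const : ∀ n c → ∑[ i < n ] c ≡ n * c
∑-const zero    c = refl
∑-const (suc n) c = cong (c +_) (∑-const n c)

∑-select : ∀ {n} (i : Fin n) (f : Fin n → ℕ) → ∑[ j < n ] (f j * 𝟙 (i ≟ j)) ≡ f i
∑-select {suc n} zero f = begin
  f zero * 1 + ∑[ j < n ] (f (suc j) * 0)
    ≡⟨ cong₂ _+_ (*-identityʳ (f zero)) (sum-cong-≗ (*-zeroʳ ∘ f ∘ suc)) ⟩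
  f zero + ∑[ j < n ] 0
    ≡⟨ cong (f zero +_) (trans (∑-const n 0) (*-zeroʳ n)) ⟩
  f zero + 0
    ≡⟨ +-identityʳ (f zero) ⟩
  f zero ∎
  where open ≡-Reasoning
∑-select {suc n} (suc i) f = begin
  f zero * 0 + ∑[ j < n ] (f (suc j) * 𝟙 (suc i ≟ suc j))
    ≡⟨ cong (f zero * 0 +_) (sum-cong-≗ λ j → cong (f (suc j) *_) (𝟙-suc j)) ⟩
  f zero * 0 + ∑[ j < n ] (f (suc j) * 𝟙 (i ≟ j))
    ≡⟨ cong₂ _+_ (*-zeroʳ (f zero)) (∑-select i (f ∘ suc)) ⟩
  f (suc i)
    ∎
  where
  open ≡-Reasoning
  𝟙-suc : ∀ j → 𝟙 (suc i ≟ suc j) ≡ 𝟙 (i ≟ j)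
  𝟙-suc j = 𝟙-cong _ _ (mk⇔ suc-injective (cong suc))

∑-𝟙-≟ : ∀ {n} (i : Fin n) → ∑[ j < n ] 𝟙 (i ≟ j) ≡ 1
∑-𝟙-≟ i = trans (sum-cong-≗ λ j → sym (*-identityˡ (𝟙 (i ≟ j)))) (∑-select i (λ _ → 1))

_≟₂_ : ∀ {n} (e e′ : Fin n × Fin n) → Dec (e ≡ e′)
_≟₂_ = ×-≡-dec _≟_ _≟_

∑∑-𝟙-≟ : ∀ {n} (e : Fin n × Fin n) → ∑[ p < n ] ∑[ q < n ] 𝟙 (e ≟₂ (p , q)) ≡ 1
∑∑-𝟙-≟ {n} (a , b) = begin
  ∑[ p < n ] ∑[ q < n ] 𝟙 ((a , b) ≟₂ (p , q))
    ≡⟨ sum-cong-≗ {n} (λ p → sum-cong-≗ {n} (𝟙-pair p)) ⟩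
  ∑[ p < n ] ∑[ q < n ] (𝟙 (a ≟ p) * 𝟙 (b ≟ q))
    ≡⟨ sum-cong-≗ {n} (λ p → *-distribˡ-sum {n} (𝟙 (a ≟ p)) λ q → 𝟙 (b ≟ q)) ⟨
  ∑[ p < n ] (𝟙 (a ≟ p) * ∑[ q < n ] 𝟙 (b ≟ q))
    ≡⟨ sum-cong-≗ {n} (λ p → cong (𝟙 (a ≟ p) *_) (∑-𝟙-≟ b)) ⟩
  ∑[ p < n ] (𝟙 (a ≟ p) * 1)
    ≡⟨ sum-cong-≗ {n} (λ p → *-identityʳ (𝟙 (a ≟ p))) ⟩
  ∑[ p < n ] 𝟙 (a ≟ p)
    ≡⟨ ∑-𝟙-≟ a ⟩
  1 ∎
  where
  open ≡-Reasoning
  𝟙-pair : ∀ p q → 𝟙 ((a , b) ≟₂ (p , q)) ≡ 𝟙 (a ≟ p) * 𝟙 (b ≟ q)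
  𝟙-pair p q = trans (𝟙-cong _ (a ≟ p ×-dec b ≟ q) (mk⇔ ,-injective λ (a≡p , b≡q) → cong₂ _,_ a≡p b≡q))
                     (𝟙-× (a ≟ p) (b ≟ q))

∑-maximum : ∀ n (f : Fin (suc n) → ℕ) → Σ (Fin (suc n)) λ v → ∑[ i < suc n ] f i ≤ suc n * f v
∑-maximum n f = v , ≤-trans (∑-mono-≤ f≤fv) (≤-reflexive (∑-const (suc n) (f v)))
  where
  argmax : ∀ n (f : Fin (suc n) → ℕ) → Σ (Fin (suc n)) λ v → ∀ w → f w ≤ f v
  argmax zero    f = zero , λ { zero → ≤-refl }
  argmax (suc n) f with argmax n (f ∘ suc)
  ... | v , max with f zero ≤? f (suc v)
  ...   | yes f0≤ = suc v , λ { zero → f0≤ ; (suc w) → max w }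
  ...   | no  f0≰ = zero , λ { zero → ≤-refl ; (suc w) → ≤-trans (max w) (≰⇒≥ f0≰) }
  v : Fin (suc n)
  v = proj₁ (argmax n f)
  f≤fv : ∀ w → f w ≤ f v
  f≤fv = proj₂ (argmax n f)

∑-telescope-≤ : ∀ {n} (g : Fin n → ℕ) (r : ℕ → ℕ) →
  (∀ t → g t + r (suc (toℕ t)) ≤ r (toℕ t)) → ∑[ t < n ] g t + r n ≤ r 0
∑-telescope-≤ {zero}  g r decrease = ≤-refl
∑-telescope-≤ {suc n} g r decrease = begin
  g zero + ∑[ t < n ] g (suc t) + r (suc n)
    ≡⟨ +-assoc (g zero) _ _ ⟩
  g zero + (∑[ t < n ] g (suc t) + r (suc n))
    ≤⟨ +-monoʳ-≤ (g zero) (∑-telescope-≤ (g ∘ suc) (r ∘ suc) (decrease ∘ suc)) ⟩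
  g zero + r 1
    ≤⟨ decrease zero ⟩
  r 0 ∎
  where open ≤-Reasoning

length-filter-tabulate : ∀ {a p} {A : Set a} {P : Pred A p} (P? : Decidable P) {n} (f : Fin n → A) →
  length (filter P? (tabulate f)) ≡ ∑[ i < n ] 𝟙 (P? (f i))
length-filter-tabulate P? {zero}  f = refl
length-filter-tabulate P? {suc n} f with P? (f zero)
... | yes _ = cong suc (length-filter-tabulate P? (f ∘ suc))
... | no _  = length-filter-tabulate P? (f ∘ suc)

Distinct : ∀ {n} → Fin n → Fin n → Fin n → Set
Distinct x y z = x ≢ y × y ≢ z × z ≢ x

distinct? : ∀ {n} (x y z : Fin n) → Dec (Distinct x y z)
distinct? x y z = ¬? (x ≟ y) ×-dec ¬? (y ≟ z) ×-dec ¬? (z ≟ x)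

Distinct-rotate : ∀ {n} {x y z : Fin n} → Distinct x y z → Distinct y z x
Distinct-rotate (x≢y , y≢z , z≢x) = y≢z , z≢x , x≢y

module TripleSums (n : ℕ) where

  ∑³ : (Fin n → Fin n → Fin n → ℕ) → ℕ
  ∑³ h = ∑[ x < n ] ∑[ y < n ] ∑[ z < n ] h x y z

  ∑³-mono-≤ : {f g : Fin n → Fin n → Fin n → ℕ} → (∀ x y z → f x y z ≤ g x y z) → ∑³ f ≤ ∑³ g
  ∑³-mono-≤ f≤g = ∑-mono-≤ λ x → ∑-mono-≤ λ y → ∑-mono-≤ λ z → f≤g x y z

  ∑³-distrib-+ : (f g : Fin n → Fin n → Fin n → ℕ) → ∑³ (λ x y z → f x y z + g x y z) ≡ ∑³ f + ∑³ g
  ∑³-distrib-+ f g = trans (sum-cong-≗ λ x → trans (sum-cong-≗ λ y → ∑-distrib-+ (f x y) (g x y))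
                                                    (∑-distrib-+ (∑² (f x)) (∑² (g x))))
                           (∑-distrib-+ (λ x → ∑[ y < n ] ∑² (f x) y) (λ x → ∑[ y < n ] ∑² (g x) y))
    where
    ∑² : (Fin n → Fin n → ℕ) → Fin n → ℕ
    ∑² h y = ∑[ z < n ] h y z

  ∑³-rotate : (h : Fin n → Fin n → Fin n → ℕ) → ∑³ (λ x y z → h y z x) ≡ ∑³ h
  ∑³-rotate h = trans (∑-comm {n} {n} λ x y → ∑[ z < n ] h y z x)
                      (sum-cong-≗ λ y → ∑-comm {n} {n} λ x z → h y z x)

  ∑³-rotations : (h : Fin n → Fin n → Fin n → ℕ) → ∑³ (λ x y z → h x y z + h y z x + h z x y) ≡ 3 * ∑³ h
  ∑³-rotations h = begin
    ∑³ (λ x y z → h x y z + h y z x + h z x y)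
      ≡⟨ ∑³-distrib-+ _ _ ⟩
    ∑³ (λ x y z → h x y z + h y z x) + ∑³ (λ x y z → h z x y)
      ≡⟨ cong₂ _+_ (∑³-distrib-+ _ _) (trans (∑³-rotate _) (∑³-rotate h)) ⟩
    ∑³ h + ∑³ (λ x y z → h y z x) + ∑³ h
      ≡⟨ cong (λ s → ∑³ h + s + ∑³ h) (∑³-rotate h) ⟩
    ∑³ h + ∑³ h + ∑³ h
      ≡⟨ thrice (∑³ h) ⟩
    3 * ∑³ h ∎
    where
    open ≡-Reasoning
    thrice : ∀ s → s + s + s ≡ 3 * s
    thrice = solve-∀

  ∑³-ones : ∑³ (λ _ _ _ → 1) ≡ n * n * n
  ∑³-ones = begin
    ∑[ x < n ] ∑[ y < n ] ∑[ z < n ] 1  ≡⟨ sum-cong-≗ {n} (λ x → sum-cong-≗ {n} λ y → ∑-const n 1) ⟩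
    ∑[ x < n ] ∑[ y < n ] (n * 1)       ≡⟨ sum-cong-≗ {n} (λ x → ∑-const n (n * 1)) ⟩
    ∑[ x < n ] (n * (n * 1))            ≡⟨ ∑-const n (n * (n * 1)) ⟩
    n * (n * (n * 1))                   ≡⟨ cube n ⟩
    n * n * n                           ∎
    where
    open ≡-Reasoning
    cube : ∀ m → m * (m * (m * 1)) ≡ m * m * m
    cube = solve-∀

  ∑³-diagonal : ∑³ (λ x y _ → 𝟙 (x ≟ y)) ≡ n * n
  ∑³-diagonal = begin
    ∑[ x < n ] ∑[ y < n ] ∑[ z < n ] 𝟙 (x ≟ y)
      ≡⟨ sum-cong-≗ {n} (λ x → sum-cong-≗ {n} λ y → ∑-const n (𝟙 (x ≟ y))) ⟩
    ∑[ x < n ] ∑[ y < n ] (n * 𝟙 (x ≟ y))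
      ≡⟨ sum-cong-≗ {n} (λ x → *-distribˡ-sum n (λ y → 𝟙 (x ≟ y))) ⟨
    ∑[ x < n ] (n * ∑[ y < n ] 𝟙 (x ≟ y))
      ≡⟨ sum-cong-≗ {n} (λ x → cong (n *_) (∑-𝟙-≟ x)) ⟩
    ∑[ x < n ] (n * 1)
      ≡⟨ ∑-const n (n * 1) ⟩
    n * (n * 1)
      ≡⟨ cong (n *_) (*-identityʳ n) ⟩
    n * n ∎
    where open ≡-Reasoning

  distinctTriples : ℕ
  distinctTriples = ∑³ (λ x y z → 𝟙 (distinct? x y z))

  distinctTriples-≥ : n * n * n ≤ distinctTriples + 3 * (n * n)
  distinctTriples-≥ = begin
    n * n * n
      ≡⟨ ∑³-ones ⟨
    ∑³ (λ _ _ _ → 1)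
      ≤⟨ ∑³-mono-≤ distinct-or-equal ⟩
    ∑³ (λ x y z → 𝟙 (distinct? x y z) + (diagonal x y z + diagonal y z x + diagonal z x y))
      ≡⟨ ∑³-distrib-+ _ _ ⟩
    distinctTriples + ∑³ (λ x y z → diagonal x y z + diagonal y z x + diagonal z x y)
      ≡⟨ cong (distinctTriples +_) (∑³-rotations diagonal) ⟩
    distinctTriples + 3 * ∑³ diagonal
      ≡⟨ cong (λ s → distinctTriples + 3 * s) ∑³-diagonal ⟩
    distinctTriples + 3 * (n * n) ∎
    where
    open ≤-Reasoning
    diagonal : Fin n → Fin n → Fin n → ℕ
    diagonal x y _ = 𝟙 (x ≟ y)
    distinct-or-equal : ∀ x y z → 1 ≤ 𝟙 (distinct? x y z) + (diagonal x y z + diagonal y z x + diagonal z x y)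
    distinct-or-equal x y z with x ≟ y | y ≟ z | z ≟ x
    ... | yes _ | _     | _     = s≤s z≤n
    ... | no _  | yes _ | _     = s≤s z≤n
    ... | no _  | no _  | yes _ = s≤s z≤n
    ... | no _  | no _  | no _  = s≤s z≤n

lookup-∈-take : ∀ {a} {A : Set a} (xs : List A) (i : Fin (length xs)) {m} →
  toℕ i < m → lookup xs i ∈ take m xs
lookup-∈-take (x ∷ xs) zero    {suc m} _         = here refl
lookup-∈-take (x ∷ xs) (suc i) {suc m} (s≤s i<m) = there (lookup-∈-take xs i i<m)

lookup-injective : ∀ {a} {A : Set a} {xs : List A} → Unique xs → ∀ {i j} →
  lookup xs i ≡ lookup xs j → i ≡ j
lookup-injective {xs = x ∷ xs} (_ ∷ _)  {zero}  {zero}  _  = refl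
lookup-injective {xs = x ∷ xs} (x∉ ∷ _) {zero}  {suc j} eq = ⊥-elim (All.lookup x∉ (∈-lookup j) eq)
lookup-injective {xs = x ∷ xs} (x∉ ∷ _) {suc i} {zero}  eq = ⊥-elim (All.lookup x∉ (∈-lookup i) (sym eq))
lookup-injective {xs = x ∷ xs} (_ ∷ u)  {suc i} {suc j} eq = cong suc (lookup-injective u eq)

two-of-three-not-least : ∀ {m} {t₁ t₂ t₃ : Fin m} {c₁ c₂ c₃ : ℕ} → t₁ ≢ t₂ → t₂ ≢ t₃ → t₃ ≢ t₁ →
  (t₂ <ᶠ t₁ ⊎ t₃ <ᶠ t₁ → 1 ≤ c₁) →
  (t₃ <ᶠ t₂ ⊎ t₁ <ᶠ t₂ → 1 ≤ c₂) →
  (t₁ <ᶠ t₃ ⊎ t₂ <ᶠ t₃ → 1 ≤ c₃) →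
  2 ≤ c₁ + c₂ + c₃
two-of-three-not-least {t₁ = t₁} {t₂} {t₃} {c₁} {c₂} {c₃} t₁≢t₂ t₂≢t₃ t₃≢t₁ late₁ late₂ late₃
  with <-cmp t₁ t₂
... | tri≈ _ t₁≡t₂ _ = ⊥-elim (t₁≢t₂ t₁≡t₂)
... | tri< t₁<t₂ _ _ with <-cmp t₁ t₃
...   | tri≈ _ t₁≡t₃ _ = ⊥-elim (t₃≢t₁ (sym t₁≡t₃))
...   | tri< t₁<t₃ _ _ = ≤-trans (+-mono-≤ (late₂ (inj₂ t₁<t₂)) (late₃ (inj₁ t₁<t₃)))
                                 (≤-trans (m≤n+m (c₂ + c₃) c₁) (≤-reflexive (sym (+-assoc c₁ c₂ c₃))))
...   | tri> _ _ t₃<t₁ = ≤-trans (+-mono-≤ (late₁ (inj₂ t₃<t₁)) (late₂ (inj₂ t₁<t₂)))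
                                 (m≤m+n (c₁ + c₂) c₃)
two-of-three-not-least {t₁ = t₁} {t₂} {t₃} {c₁} {c₂} {c₃} t₁≢t₂ t₂≢t₃ t₃≢t₁ late₁ late₂ late₃
    | tri> _ _ t₂<t₁ with <-cmp t₂ t₃
...   | tri≈ _ t₂≡t₃ _ = ⊥-elim (t₂≢t₃ t₂≡t₃)
...   | tri< t₂<t₃ _ _ = ≤-trans (+-mono-≤ (late₁ (inj₁ t₂<t₁)) (late₃ (inj₂ t₂<t₃)))
                                 (+-monoˡ-≤ c₃ (m≤m+n c₁ c₂))
...   | tri> _ _ t₃<t₂ = ≤-trans (+-mono-≤ (late₁ (inj₁ t₂<t₁)) (late₂ (inj₁ t₃<t₂)))
                                 (m≤m+n (c₁ + c₂) c₃)

module Labelling {k : ℕ} where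

  Conn-trans : ∀ {E : List (Edge k)} {u w x} → Conn E u w → Conn E w x → Conn E u x
  Conn-trans p here       = p
  Conn-trans p (step q e) = step (Conn-trans p q) e

  Conn-sym : ∀ {E : List (Edge k)} {u w} → Conn E u w → Conn E w u
  Conn-sym here              = here
  Conn-sym (step q (inj₁ e)) = Conn-trans (step here (inj₂ e)) (Conn-sym q)
  Conn-sym (step q (inj₂ e)) = Conn-trans (step here (inj₁ e)) (Conn-sym q)

  Conn-mono : ∀ {E E′ : List (Edge k)} → E ⊆ E′ → ∀ {u w} → Conn E u w → Conn E′ u w
  Conn-mono E⊆E′ here              = here
  Conn-mono E⊆E′ (step q (inj₁ e)) = step (Conn-mono E⊆E′ q) (inj₁ (E⊆E′ e))
  Conn-mono E⊆E′ (step q (inj₂ e)) = step (Conn-mono E⊆E′ q) (inj₂ (E⊆E′ e))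

  replace : Fin k → Fin k → Fin k → Fin k
  replace a b c with c ≟ b
  ... | yes _ = a
  ... | no _  = c

  replace-self : ∀ a b → replace a b a ≡ a
  replace-self a b with a ≟ b
  ... | yes _ = refl
  ... | no _  = refl

  replace-target : ∀ a b → replace a b b ≡ a
  replace-target a b with b ≟ b
  ... | yes _   = refl
  ... | no b≢b = ⊥-elim (b≢b refl)

  merge : (Fin k → Fin k) → Edge k → Fin k → Fin k
  merge f (x , y) u = replace (f x) (f y) (f u)

  labelling : List (Edge k) → Fin k → Fin k
  labelling = foldl merge id

  record IsLabelling (E : List (Edge k)) (f : Fin k → Fin k) : Set where
    field
      sound      : ∀ u → Conn E (f u) u
      respects   : ∀ {p q} → (p , q) ∈ E → f p ≡ f q
      idempotent : ∀ u → f (f u) ≡ f u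

  id-isLabelling : IsLabelling [] id
  id-isLabelling = record { sound = λ _ → here ; respects = λ () ; idempotent = λ _ → refl }

  merge-isLabelling : ∀ {E f} → IsLabelling E f → ∀ e → IsLabelling (E ∷ʳ e) (merge f e)
  merge-isLabelling {E} {f} L (x , y) = record
    { sound = sound′ ; respects = respects′ ; idempotent = idempotent′ }
    where
    open IsLabelling L
    E′ : List (Edge k)
    E′ = E ∷ʳ (x , y)
    old : ∀ {u w} → Conn E u w → Conn E′ u w
    old = Conn-mono ∈-++⁺ˡ

    sound′ : ∀ u → Conn E′ (merge f (x , y) u) u
    sound′ u with f u ≟ f y
    ... | no _      = old (sound u)
    ... | yes fu≡fy = Conn-trans (step (old (sound x)) (inj₁ (∈-++⁺ʳ E (here refl))))
                        (Conn-trans (Conn-sym (old (sound y))) (subst (λ w → Conn E′ w u) fu≡fy (old (sound u))))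

    respects′ : ∀ {p q} → (p , q) ∈ E′ → merge f (x , y) p ≡ merge f (x , y) q
    respects′ pq∈ with ∈-++⁻ E pq∈
    ... | inj₁ pq∈E        = cong (replace (f x) (f y)) (respects pq∈E)
    ... | inj₂ (here refl) = trans (replace-self (f x) (f y)) (sym (replace-target (f x) (f y)))

    idempotent′ : ∀ u → merge f (x , y) (merge f (x , y) u) ≡ merge f (x , y) u
    idempotent′ u with f u ≟ f y
    ... | yes _ rewrite idempotent x = replace-self (f x) (f y)
    ... | no fu≢fy rewrite idempotent u with f u ≟ f y
    ...   | yes fu≡fy = ⊥-elim (fu≢fy fu≡fy)
    ...   | no _      = refl

  foldl-merge-isLabelling : ∀ {E f} → IsLabelling E f → ∀ es → IsLabelling (E ++ es) (foldl merge f es)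
  foldl-merge-isLabelling {E} L []       = subst (λ E′ → IsLabelling E′ _) (sym (++-identityʳ E)) L
  foldl-merge-isLabelling {E} L (e ∷ es) =
    subst (λ E′ → IsLabelling E′ _) (++-assoc E [ e ] es) (foldl-merge-isLabelling (merge-isLabelling L e) es)

  labelling-isLabelling : ∀ E → IsLabelling E (labelling E)
  labelling-isLabelling = foldl-merge-isLabelling id-isLabelling

  GoodEdge : (Fin k → Fin k) → Fin k → Edge k → Set
  GoodEdge f v (p , q) = p ≢ v × q ≢ v × f v ≡ f p × f v ≡ f q

  goodEdge? : ∀ f v e → Dec (GoodEdge f v e)
  goodEdge? f v (p , q) = ¬? (p ≟ v) ×-dec ¬? (q ≟ v) ×-dec f v ≟ f p ×-dec f v ≟ f q

  GoodEdge-sound : ∀ {E f} → IsLabelling E f → ∀ {v p q} → GoodEdge f v (p , q) →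
    p ≢ v × q ≢ v × Conn E v p × Conn E v q
  GoodEdge-sound {E} {f} L {v} (p≢v , q≢v , vp , vq) = p≢v , q≢v , via vp , via vq
    where
    open IsLabelling L
    via : ∀ {w} → f v ≡ f w → Conn E v w
    via {w} fv≡fw = Conn-trans (Conn-sym (sound v)) (subst (λ c → Conn E c w) (sym fv≡fw) (sound w))

  separates? : (f : Fin k → Fin k) (e : Edge k) → Dec (f (proj₁ e) ≢ f (proj₂ e))
  separates? f (x , y) = ¬? (f x ≟ f y)

  roots : (Fin k → Fin k) → ℕ
  roots f = ∑[ u < k ] 𝟙 (f u ≟ u)

  merge-root≤root : ∀ {f} → (∀ u → f (f u) ≡ f u) → ∀ e u → 𝟙 (merge f e u ≟ u) ≤ 𝟙 (f u ≟ u)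
  merge-root≤root {f} idem (x , y) u = 𝟙-mono _ _ root
    where
    root : merge f (x , y) u ≡ u → f u ≡ u
    root eq with f u ≟ f y
    ... | no _  = eq
    ... | yes _ = trans (cong f (sym eq)) (trans (idem x) eq)

  -- A merge across two classes turns the root f y into a non-root and creates no new root.
  roots-merge : ∀ {f} → (∀ u → f (f u) ≡ f u) → ∀ e → roots (merge f e) + 𝟙 (separates? f e) ≤ roots f
  roots-merge {f} idem (x , y) with f x ≟ f y
  ... | yes _    = ≤-trans (≤-reflexive (+-identityʳ _)) (∑-mono-≤ (merge-root≤root idem (x , y)))
  ... | no fx≢fy = ≤-trans (≤-reflexive (+-comm _ 1)) (∑-mono-< (merge-root≤root idem (x , y)) (f y) root-lost)
    where
    root-lost : 𝟙 (merge f (x , y) (f y) ≟ f y) < 𝟙 (f (f y) ≟ f y)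
    root-lost rewrite idem y | replace-target (f x) (f y) | 𝟙-no (f x ≟ f y) fx≢fy | 𝟙-yes (f y ≟ f y) refl
      = s≤s z≤n

counting-arithmetic : ∀ {k d g m} → k * k * k ≤ d + 3 * (k * k) → d + d ≤ 3 * (2 * (g + k * m)) → m ≤ k →
  k * k * k ≤ 3 * g + 6 * (k * k)
counting-arithmetic {k} {d} {g} {m} k³≤ d+d≤ m≤k = begin
  k * k * k                      ≤⟨ k³≤ ⟩
  d + 3 * (k * k)                ≤⟨ +-monoˡ-≤ (3 * (k * k)) d≤ ⟩
  3 * (g + k * m) + 3 * (k * k)  ≤⟨ +-monoˡ-≤ (3 * (k * k)) (*-monoʳ-≤ 3 (+-monoʳ-≤ g (*-monoʳ-≤ k m≤k))) ⟩
  3 * (g + k * k) + 3 * (k * k)  ≡⟨ regroup g (k * k) ⟩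
  3 * g + 6 * (k * k)            ∎
  where
  open ≤-Reasoning
  regroup : ∀ a b → 3 * (a + b) + 3 * b ≡ 3 * a + 6 * b
  regroup = solve-∀
  double : ∀ a → a + a ≡ 2 * a
  double = solve-∀
  commute : ∀ b → 3 * (2 * b) ≡ 2 * (3 * b)
  commute = solve-∀
  d≤ : d ≤ 3 * (g + k * m)
  d≤ = *-cancelˡ-≤ 2 (subst₂ _≤_ (double d) (commute (g + k * m)) d+d≤)

module EdgeOrdering {k : ℕ} (es : List (Edge k)) (ord : IsEdgeOrdering k es) where

  open Labelling {k}
  open TripleSums k

  Time : Set
  Time = Fin (length es)

  labelsBefore : ℕ → Fin k → Fin k
  labelsBefore m = labelling (take m es)

  label : Time → Fin k → Fin k
  label t = labelsBefore (toℕ t)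

  label-isLabelling : ∀ t → IsLabelling (take (toℕ t) es) (label t)
  label-isLabelling t = labelling-isLabelling (take (toℕ t) es)

  labelsBefore-suc : ∀ t → labelsBefore (suc (toℕ t)) ≡ merge (label t) (lookup es t)
  labelsBefore-suc t =
    trans (cong labelling (take-suc es t)) (foldl-∷ʳ merge id (lookup es t) (take (toℕ t) es))

  merging : Time → ℕ
  merging t = 𝟙 (separates? (label t) (lookup es t))

  merges : ℕ
  merges = ∑[ t < length es ] merging t

  merges≤k : merges ≤ k
  merges≤k = begin
    merges                                     ≤⟨ m≤m+n _ _ ⟩
    merges + roots (labelsBefore (length es))  ≤⟨ ∑-telescope-≤ merging (roots ∘ labelsBefore) decrease ⟩
    roots id                                   ≤⟨ ∑-mono-≤ {k} (λ u → 𝟙≤1 (u ≟ u)) ⟩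
    ∑[ u < k ] 1                               ≡⟨ ∑-const k 1 ⟩
    k * 1                                      ≡⟨ *-identityʳ k ⟩
    k                                          ∎
    where
    open ≤-Reasoning
    decrease : ∀ t → merging t + roots (labelsBefore (suc (toℕ t))) ≤ roots (label t)
    decrease t rewrite labelsBefore-suc t =
      ≤-trans (≤-reflexive (+-comm (merging t) _))
              (roots-merge (IsLabelling.idempotent (label-isLabelling t)) (lookup es t))

  increasing : ∀ {t p q} → lookup es t ≡ (p , q) → toℕ p < toℕ q
  increasing {t} eq = subst (λ e → toℕ (proj₁ e) < toℕ (proj₂ e)) eq (All.lookup (proj₁ ord) (∈-lookup t))

  Joins : Fin k → Fin k → Time → Set
  Joins p q t = lookup es t ≡ (p , q) ⊎ lookup es t ≡ (q , p)

  joins? : ∀ p q t → Dec (Joins p q t)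
  joins? p q t = (lookup es t ≟₂ (p , q)) ⊎-dec (lookup es t ≟₂ (q , p))

  Joins-ends : ∀ {p q p′ q′ t} → Joins p q t → Joins p′ q′ t → (p ≡ p′ × q ≡ q′) ⊎ (p ≡ q′ × q ≡ p′)
  Joins-ends (inj₁ e) (inj₁ e′) = inj₁ (,-injective (trans (sym e) e′))
  Joins-ends (inj₁ e) (inj₂ e′) = inj₂ (,-injective (trans (sym e) e′))
  Joins-ends (inj₂ e) (inj₁ e′) = inj₂ (swap (,-injective (trans (sym e) e′)))
  Joins-ends (inj₂ e) (inj₂ e′) = inj₁ (swap (,-injective (trans (sym e) e′)))

  Joins-unique : ∀ {p q t s} → Joins p q t → Joins p q s → t ≡ s
  Joins-unique (inj₁ e) (inj₁ e′) = lookup-injective (proj₁ (proj₂ ord)) (trans e (sym e′))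
  Joins-unique (inj₂ e) (inj₂ e′) = lookup-injective (proj₁ (proj₂ ord)) (trans e (sym e′))
  Joins-unique (inj₁ e) (inj₂ e′) = ⊥-elim (<-asym (increasing e) (increasing e′))
  Joins-unique (inj₂ e) (inj₁ e′) = ⊥-elim (<-asym (increasing e) (increasing e′))

  joiningTime : ∀ {p q} → p ≢ q → Σ Time (Joins p q)
  joiningTime {p} {q} p≢q with <-cmp p q
  ... | tri< p<q _ _ = let pq∈ = proj₂ (proj₂ ord) p q p<q in index pq∈ , inj₁ (sym (lookup-index pq∈))
  ... | tri≈ _ p≡q _ = ⊥-elim (p≢q p≡q)
  ... | tri> _ _ q<p = let qp∈ = proj₂ (proj₂ ord) q p q<p in index qp∈ , inj₂ (sym (lookup-index qp∈))

  -- F at the time the edge pq is added, written as a sum over all times so that sums over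
  -- vertex pairs can be exchanged with sums over times.
  atEdge : (Time → ℕ) → Fin k → Fin k → ℕ
  atEdge F p q = ∑[ t < length es ] (F t * 𝟙 (joins? p q t))

  atEdge-joins : ∀ F {p q t} → Joins p q t → atEdge F p q ≡ F t
  atEdge-joins F {p} {q} {t} J = trans (sum-cong-≗ λ s → cong (F s *_) (only-t s)) (∑-select t F)
    where
    only-t : ∀ s → 𝟙 (joins? p q s) ≡ 𝟙 (t ≟ s)
    only-t s = 𝟙-cong (joins? p q s) (t ≟ s) (mk⇔ (Joins-unique J) λ { refl → J })

  ∑∑-joins : ∀ t → ∑[ p < k ] ∑[ q < k ] 𝟙 (joins? p q t) ≡ 2
  ∑∑-joins t = begin
    ∑[ p < k ] ∑[ q < k ] 𝟙 (joins? p q t)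
      ≡⟨ sum-cong-≗ {k} (λ p → sum-cong-≗ {k} λ q → 𝟙-⊎ (e ≟₂ (p , q)) (e ≟₂ (q , p)) (loopless p q)) ⟩
    ∑[ p < k ] ∑[ q < k ] (𝟙 (e ≟₂ (p , q)) + 𝟙 (e ≟₂ (q , p)))
      ≡⟨ sum-cong-≗ {k} (λ p → ∑-distrib-+ (λ q → 𝟙 (e ≟₂ (p , q))) (λ q → 𝟙 (e ≟₂ (q , p)))) ⟩
    ∑[ p < k ] (∑[ q < k ] 𝟙 (e ≟₂ (p , q)) + ∑[ q < k ] 𝟙 (e ≟₂ (q , p)))
      ≡⟨ ∑-distrib-+ {k} _ _ ⟩
    ∑[ p < k ] ∑[ q < k ] 𝟙 (e ≟₂ (p , q)) + ∑[ p < k ] ∑[ q < k ] 𝟙 (e ≟₂ (q , p))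
      ≡⟨ cong (∑[ p < k ] ∑[ q < k ] 𝟙 (e ≟₂ (p , q)) +_) (∑-comm {k} {k} λ p q → 𝟙 (e ≟₂ (q , p))) ⟩
    ∑[ p < k ] ∑[ q < k ] 𝟙 (e ≟₂ (p , q)) + ∑[ q < k ] ∑[ p < k ] 𝟙 (e ≟₂ (q , p))
      ≡⟨ cong₂ _+_ (∑∑-𝟙-≟ e) (∑∑-𝟙-≟ e) ⟩
    2 ∎
    where
    open ≡-Reasoning
    e : Edge k
    e = lookup es t
    loopless : ∀ p q → e ≡ (p , q) → e ≢ (q , p)
    loopless p q e≡pq e≡qp =
      <-irrefl (cong toℕ (proj₁ (,-injective (trans (sym e≡pq) e≡qp)))) (increasing e≡pq)

  ∑∑-atEdge : ∀ F → ∑[ p < k ] ∑[ q < k ] atEdge F p q ≡ 2 * ∑[ t < length es ] F t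
  ∑∑-atEdge F = begin
    ∑[ p < k ] ∑[ q < k ] ∑[ t < length es ] (F t * 𝟙 (joins? p q t))
      ≡⟨ sum-cong-≗ {k} (λ p → ∑-comm {k} {length es} _) ⟩
    ∑[ p < k ] ∑[ t < length es ] ∑[ q < k ] (F t * 𝟙 (joins? p q t))
      ≡⟨ ∑-comm {k} {length es} _ ⟩
    ∑[ t < length es ] ∑[ p < k ] ∑[ q < k ] (F t * 𝟙 (joins? p q t))
      ≡⟨ sum-cong-≗ {length es} factor ⟩
    ∑[ t < length es ] (F t * 2)
      ≡⟨ sum-cong-≗ {length es} (λ t → *-comm (F t) 2) ⟩
    ∑[ t < length es ] (2 * F t)
      ≡⟨ *-distribˡ-sum 2 F ⟨
    2 * ∑[ t < length es ] F t ∎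
    where
    open ≡-Reasoning
    factor : ∀ t → ∑[ p < k ] ∑[ q < k ] (F t * 𝟙 (joins? p q t)) ≡ F t * 2
    factor t = begin
      ∑[ p < k ] ∑[ q < k ] (F t * 𝟙 (joins? p q t))
        ≡⟨ sum-cong-≗ {k} (λ p → *-distribˡ-sum (F t) (λ q → 𝟙 (joins? p q t))) ⟨
      ∑[ p < k ] (F t * ∑[ q < k ] 𝟙 (joins? p q t))
        ≡⟨ *-distribˡ-sum (F t) (λ p → ∑[ q < k ] 𝟙 (joins? p q t)) ⟨
      F t * ∑[ p < k ] ∑[ q < k ] 𝟙 (joins? p q t)
        ≡⟨ cong (F t *_) (∑∑-joins t) ⟩
      F t * 2 ∎

  good? : ∀ v t → Dec (GoodEdge (label t) v (lookup es t))
  good? v t = goodEdge? (label t) v (lookup es t)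

  GoodEdge⇒Good : ∀ {v t} → GoodEdge (label t) v (lookup es t) → Good es v t
  GoodEdge⇒Good {t = t} = GoodEdge-sound (label-isLabelling t)

  Joins-good : ∀ {p q v t} → Joins p q t → p ≢ v → q ≢ v →
    label t v ≡ label t p → label t v ≡ label t q → GoodEdge (label t) v (lookup es t)
  Joins-good {t = t} (inj₁ e) p≢v q≢v vp vq = subst (GoodEdge (label t) _) (sym e) (p≢v , q≢v , vp , vq)
  Joins-good {t = t} (inj₂ e) p≢v q≢v vp vq = subst (GoodEdge (label t) _) (sym e) (q≢v , p≢v , vq , vp)

  Joins-unseparated : ∀ {p q t} → Joins p q t →
    ¬ label t (proj₁ (lookup es t)) ≢ label t (proj₂ (lookup es t)) → label t p ≡ label t q
  Joins-unseparated {t = t} J unseparated with J | decidable-stable (_ ≟ _) unseparated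
  ... | inj₁ e | same = subst (λ e → label t (proj₁ e) ≡ label t (proj₂ e)) e same
  ... | inj₂ e | same = sym (subst (λ e → label t (proj₁ e) ≡ label t (proj₂ e)) e same)

  Joins-earlier : ∀ {p q s t} → Joins p q s → s <ᶠ t → label t p ≡ label t q
  Joins-earlier {s = s} {t} (inj₁ e) s<t = respects (subst (_∈ take (toℕ t) es) e (lookup-∈-take es s s<t))
    where open IsLabelling (label-isLabelling t)
  Joins-earlier {s = s} {t} (inj₂ e) s<t = sym (respects (subst (_∈ take (toℕ t) es) e (lookup-∈-take es s s<t)))
    where open IsLabelling (label-isLabelling t)

  credit : Fin k → Time → ℕ
  credit v t = 𝟙 (good? v t) + merging t

  -- If yz is not the first edge of the triangle xyz, then adding it either merges two
  -- components, or y and z are already connected and one of them is connected to x.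
  credit-not-first : ∀ {x y z t s r} → Distinct x y z → Joins y z t → Joins z x s → Joins x y r →
    s <ᶠ t ⊎ r <ᶠ t → 1 ≤ credit x t
  credit-not-first {x} {y} {z} {t} (x≢y , _ , z≢x) J₁ J₂ J₃ not-first with separates? (label t) (lookup es t)
  ... | yes _          = m≤n+m 1 (𝟙 (good? x t))
  ... | no unseparated = ≤-trans (≤-reflexive (sym (𝟙-yes (good? x t) good))) (m≤m+n (𝟙 (good? x t)) 0)
    where
    yz : label t y ≡ label t z
    yz = Joins-unseparated J₁ unseparated
    xy : label t x ≡ label t y
    xy = [ (λ s<t → trans (sym (Joins-earlier J₂ s<t)) (sym yz)) , Joins-earlier J₃ ]′ not-first
    good : GoodEdge (label t) x (lookup es t)
    good = Joins-good J₁ (≢-sym x≢y) z≢x xy (trans xy yz)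

  times-differ : ∀ {x y z t s} → Distinct x y z → Joins y z t → Joins z x s → t ≢ s
  times-differ (x≢y , y≢z , _) J₁ J₂ refl with Joins-ends J₁ J₂
  ... | inj₁ (y≡z , _) = y≢z y≡z
  ... | inj₂ (y≡x , _) = x≢y (sym y≡x)

  triangle : ∀ {x y z} → Distinct x y z →
    2 ≤ atEdge (credit x) y z + atEdge (credit y) z x + atEdge (credit z) x y
  triangle {x} {y} {z} d = subst (2 ≤_) (sym at-joining-times)
    (two-of-three-not-least (times-differ d J₁ J₂) (times-differ d′ J₂ J₃) (times-differ d″ J₃ J₁)
      (credit-not-first d J₁ J₂ J₃) (credit-not-first d′ J₂ J₃ J₁) (credit-not-first d″ J₃ J₁ J₂))
    where
    d′ : Distinct y z x
    d′ = Distinct-rotate d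
    d″ : Distinct z x y
    d″ = Distinct-rotate d′
    yz : Σ Time (Joins y z)
    yz = joiningTime (proj₁ d′)
    zx : Σ Time (Joins z x)
    zx = joiningTime (proj₁ d″)
    xy : Σ Time (Joins x y)
    xy = joiningTime (proj₁ d)
    J₁ : Joins y z (proj₁ yz)
    J₁ = proj₂ yz
    J₂ : Joins z x (proj₁ zx)
    J₂ = proj₂ zx
    J₃ : Joins x y (proj₁ xy)
    J₃ = proj₂ xy
    at-joining-times : atEdge (credit x) y z + atEdge (credit y) z x + atEdge (credit z) x y
                     ≡ credit x (proj₁ yz) + credit y (proj₁ zx) + credit z (proj₁ xy)
    at-joining-times = cong₂ _+_ (cong₂ _+_ (atEdge-joins (credit x) J₁) (atEdge-joins (credit y) J₂))
                                 (atEdge-joins (credit z) J₃)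

  goodCount : Fin k → ℕ
  goodCount v = ∑[ t < length es ] 𝟙 (good? v t)

  goodTotal : ℕ
  goodTotal = ∑[ v < k ] goodCount v

  ∑³-credit : ∑³ (λ x y z → atEdge (credit x) y z) ≡ 2 * (goodTotal + k * merges)
  ∑³-credit = begin
    ∑[ x < k ] ∑[ y < k ] ∑[ z < k ] atEdge (credit x) y z
      ≡⟨ sum-cong-≗ {k} (λ x → ∑∑-atEdge (credit x)) ⟩
    ∑[ x < k ] (2 * ∑[ t < length es ] credit x t)
      ≡⟨ *-distribˡ-sum 2 (λ x → ∑[ t < length es ] credit x t) ⟨
    2 * ∑[ x < k ] ∑[ t < length es ] credit x t
      ≡⟨ cong (2 *_) (sum-cong-≗ {k} λ x → ∑-distrib-+ (λ t → 𝟙 (good? x t)) merging) ⟩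
    2 * ∑[ x < k ] (goodCount x + merges)
      ≡⟨ cong (2 *_) (∑-distrib-+ goodCount (λ _ → merges)) ⟩
    2 * (goodTotal + ∑[ x < k ] merges)
      ≡⟨ cong (λ m → 2 * (goodTotal + m)) (∑-const k merges) ⟩
    2 * (goodTotal + k * merges) ∎
    where open ≡-Reasoning

  counting : k * k * k ≤ 3 * goodTotal + 6 * (k * k)
  counting = counting-arithmetic {d = distinctTriples} {goodTotal} {merges} distinctTriples-≥ triangles merges≤k
    where
    doubled : ∀ x y z → 𝟙 (distinct? x y z) + 𝟙 (distinct? x y z) ≤
                         atEdge (credit x) y z + atEdge (credit y) z x + atEdge (credit z) x y
    doubled x y z with distinct? x y z
    ... | yes d = triangle d
    ... | no _  = z≤n
    triangles : distinctTriples + distinctTriples ≤ 3 * (2 * (goodTotal + k * merges))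
    triangles = begin
      distinctTriples + distinctTriples
        ≡⟨ ∑³-distrib-+ _ _ ⟨
      ∑³ (λ x y z → 𝟙 (distinct? x y z) + 𝟙 (distinct? x y z))
        ≤⟨ ∑³-mono-≤ doubled ⟩
      ∑³ (λ x y z → atEdge (credit x) y z + atEdge (credit y) z x + atEdge (credit z) x y)
        ≡⟨ ∑³-rotations (λ x y z → atEdge (credit x) y z) ⟩
      3 * ∑³ (λ x y z → atEdge (credit x) y z)
        ≡⟨ cong (3 *_) ∑³-credit ⟩
      3 * (2 * (goodTotal + k * merges)) ∎
      where open ≤-Reasoning

  goodList : Fin k → List Time
  goodList v = filter (good? v) (allFin (length es))

  goodList-unique : ∀ v → Unique (goodList v)
  goodList-unique v = Unique.filter⁺ (good? v) (Unique.allFin⁺ (length es))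

  goodList-good : ∀ v → All (Good es v) (goodList v)
  goodList-good v = All.map GoodEdge⇒Good (all-filter (good? v) (allFin (length es)))

  length-goodList : ∀ v → length (goodList v) ≡ goodCount v
  length-goodList v = length-filter-tabulate (good? v) id

many-good : ∀ {k′} (es : List (Edge (suc k′))) (ord : IsEdgeOrdering (suc k′) es) →
  let open EdgeOrdering es ord in Σ (Fin (suc k′)) λ v → suc k′ * suc k′ ≤ 3 * goodCount v + 6 * suc k′
many-good {k′} es ord = v , *-cancelˡ-≤ k (begin
  k * (k * k)                          ≡⟨ *-assoc k k k ⟨
  k * k * k                            ≤⟨ counting ⟩
  3 * goodTotal + 6 * (k * k)          ≤⟨ +-monoˡ-≤ (6 * (k * k)) (*-monoʳ-≤ 3 goodTotal≤) ⟩
  3 * (k * goodCount v) + 6 * (k * k)  ≡⟨ factor k (goodCount v) ⟩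
  k * (3 * goodCount v + 6 * k)        ∎)
  where
  open EdgeOrdering es ord
  open ≤-Reasoning
  k : ℕ
  k = suc k′
  v : Fin k
  v = proj₁ (∑-maximum k′ goodCount)
  goodTotal≤ : goodTotal ≤ k * goodCount v
  goodTotal≤ = proj₂ (∑-maximum k′ goodCount)
  factor : ∀ k c → 3 * (k * c) + 6 * (k * k) ≡ k * (3 * c + 6 * k)
  factor = solve-∀

^≤expSum : ∀ a n → a ^ n ≤ expSum a n
^≤expSum a zero    = ≤-refl
^≤expSum a (suc n) = m≤n+m (a ^ suc n) (suc n * expSum a n)

factorial≤^ : ∀ n → factorial n ≤ n ^ n
factorial≤^ zero    = ≤-refl
factorial≤^ (suc n) = *-monoʳ-≤ (suc n) (≤-trans (factorial≤^ n) (^-monoˡ-≤ n (n≤1+n n)))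

^-distribʳ-* : ∀ m n o → (m * n) ^ o ≡ m ^ o * n ^ o
^-distribʳ-* m n zero    = refl
^-distribʳ-* m n (suc o) = trans (cong (m * n *_) (^-distribʳ-* m n o)) (interchange m n (m ^ o) (n ^ o))
  where
  interchange : ∀ m n x y → m * n * (x * y) ≡ m * x * (n * y)
  interchange = solve-∀

^-cancelʳ-≤ : ∀ {x y} b → 0 < b → x ^ b ≤ y ^ b → x ≤ y
^-cancelʳ-≤ (suc b) _ xᵇ≤yᵇ = ≮⇒≥ λ y<x → <⇒≱ (^-monoˡ-< (suc b) y<x) xᵇ≤yᵇ

ExpLe⇒fourth-power : ∀ {a b k} → ExpLe a b k → 0 < b → a ^ 4 ≤ k * (4 * b) ^ 4
ExpLe⇒fourth-power {a} {b} {k} expLe 0<b = ^-cancelʳ-≤ b 0<b (begin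
  (a ^ 4) ^ b                ≡⟨ ^-*-assoc a 4 b ⟩
  a ^ (4 * b)                ≤⟨ ^≤expSum a (4 * b) ⟩
  expSum a (4 * b)           ≤⟨ expLe (4 * b) ⟩
  k ^ b * factorial (4 * b)  ≤⟨ *-monoʳ-≤ (k ^ b) (factorial≤^ (4 * b)) ⟩
  k ^ b * (4 * b) ^ (4 * b)  ≡⟨ cong (k ^ b *_) (^-*-assoc (4 * b) 4 b) ⟨
  k ^ b * ((4 * b) ^ 4) ^ b  ≡⟨ ^-distribʳ-* k ((4 * b) ^ 4) b ⟨
  (k * (4 * b) ^ 4) ^ b      ∎)
  where open ≤-Reasoning

ExpLe⇒square : ∀ {a b k} → ExpLe a b k → 0 < b → 1024 ≤ k → 2 * (a * a) ≤ k * (b * b)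
ExpLe⇒square {a} {b} {k} expLe 0<b 1024≤k = ^-cancelʳ-≤ 2 (s≤s z≤n) (begin
  (2 * (a * a)) ^ 2         ≡⟨ square-lhs a ⟩
  4 * a ^ 4                 ≤⟨ *-monoʳ-≤ 4 (ExpLe⇒fourth-power expLe 0<b) ⟩
  4 * (k * (4 * b) ^ 4)     ≡⟨ scale k b ⟩
  1024 * (k * (b * b) ^ 2)  ≤⟨ *-monoˡ-≤ (k * (b * b) ^ 2) 1024≤k ⟩
  k * (k * (b * b) ^ 2)     ≡⟨ square-rhs k b ⟩
  (k * (b * b)) ^ 2         ∎)
  where
  open ≤-Reasoning
  -- The ring solver does not know _^_, so the powers are unfolded in these identities.
  square-lhs : ∀ a → 2 * (a * a) * (2 * (a * a) * 1) ≡ 4 * (a * (a * (a * (a * 1))))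
  square-lhs = solve-∀
  scale : ∀ k b → 4 * (k * (4 * b * (4 * b * (4 * b * (4 * b * 1))))) ≡ 1024 * (k * (b * b * (b * b * 1)))
  scale = solve-∀
  square-rhs : ∀ k b → k * (k * (b * b * (b * b * 1))) ≡ k * (b * b) * (k * (b * b) * 1)
  square-rhs = solve-∀

final-arithmetic : ∀ {k a b c} → k * k ≤ 3 * c + 6 * k → 2 * (a * a) ≤ k * (b * b) →
  k ^ 2 * a ^ 2 ≤ 3 * a ^ 2 * c + 3 * k ^ 2 * b ^ 2
final-arithmetic {k} {a} {b} {c} k²≤ 2a²≤ = begin
  k ^ 2 * a ^ 2                          ≡⟨ expand k a ⟩
  k * k * (a * a)                        ≤⟨ *-monoˡ-≤ (a * a) k²≤ ⟩
  (3 * c + 6 * k) * (a * a)              ≡⟨ distribute k a c ⟩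
  3 * a ^ 2 * c + 3 * k * (2 * (a * a))  ≤⟨ +-monoʳ-≤ (3 * a ^ 2 * c) (*-monoʳ-≤ (3 * k) 2a²≤) ⟩
  3 * a ^ 2 * c + 3 * k * (k * (b * b))  ≡⟨ collect k a b c ⟩
  3 * a ^ 2 * c + 3 * k ^ 2 * b ^ 2      ∎
  where
  open ≤-Reasoning
  expand : ∀ k a → k * (k * 1) * (a * (a * 1)) ≡ k * k * (a * a)
  expand = solve-∀
  distribute : ∀ k a c → (3 * c + 6 * k) * (a * a) ≡ 3 * (a * (a * 1)) * c + 3 * k * (2 * (a * a))
  distribute = solve-∀
  collect : ∀ k a b c →
    3 * (a * (a * 1)) * c + 3 * k * (k * (b * b)) ≡ 3 * (a * (a * 1)) * c + 3 * (k * (k * 1)) * (b * (b * 1))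
  collect = solve-∀

lemma3 : (k : ℕ) → 10 ^ 8 ≤ k → (es : List (Edge k)) → IsEdgeOrdering k es →
    Σ (Fin k) λ v → (a b : ℕ) → 0 < b → ExpLe a b k →
    Σ (List (Fin (length es))) λ ts → Unique ts × All (Good es v) ts ×
    (k ^ 2 * a ^ 2 ≤ 3 * a ^ 2 * length ts + 3 * k ^ 2 * b ^ 2)
lemma3 zero     ()
lemma3 (suc k′) 10⁸≤k es ord = v , λ a b 0<b expLe →
  goodList v , goodList-unique v , goodList-good v ,
  subst (λ c → suc k′ ^ 2 * a ^ 2 ≤ 3 * a ^ 2 * c + 3 * suc k′ ^ 2 * b ^ 2) (sym (length-goodList v))
        (final-arithmetic {a = a} {b} many (ExpLe⇒square expLe 0<b (≤-trans 1024≤10⁸ 10⁸≤k)))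
  where
  open EdgeOrdering es ord
  v : Fin (suc k′)
  v = proj₁ (many-good es ord)
  many : suc k′ * suc k′ ≤ 3 * goodCount v + 6 * suc k′
  many = proj₂ (many-good es ord)
  1024≤10⁸ : 1024 ≤ 10 ^ 8
  1024≤10⁸ = ≤ᵇ⇒≤ 1024 (10 ^ 8) _
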